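{- For every finite multiset $G$ of I/O pairs and formulas $A,X,B,Y$: if $(A,X),G\vdash(B,Y)$ is derivable in $\mathbf{C}_3$, then $G\vdash(B\wedge X,Y\vee\neg X)$ is derivable in $\mathbf{C}_3$.
   Context: Formulas are classical propositional formulas; $\models$ is classical entailment. An LK sequent $\Gamma\Rightarrow\Delta$ is derivable in LK iff $\bigwedge\Gamma\models\bigvee\Delta$ (empty conjunction $=\top$, empty disjunction $=\bot$). An I/O pair is an ordered pair $(A,X)$ of formulas; an I/O sequent has the form $G\vdash(B,Y)$ with $G$ a finite multiset of pairs. The calculus $\mathbf{C}_3$ has the rules: (IN) from $B\Rightarrow$ infer $G\vdash(B,Y)$; (OUT) from $\Rightarrow Y$ infer $G\vdash(B,Y)$; (E3) from the LK sequent $B\Rightarrow A$ and $G\vdash(B\wedge X,Y\vee\neg X)$ infer $(A,X),G\vdash(B,Y)$. An I/O sequent is derivable in $\mathbf{C}_3$ if it is the root of a finite tree built with these rules in which every LK-sequent premise is derivable in LK. -}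

module Defs where

open import Data.Nat using (ℕ)
open import Data.Bool using (Bool; true; false; _∧_; _∨_; not)
open import Data.List using (List; []; _∷_)
open import Data.Product using (_×_; _,_)
open import Relation.Binary.PropositionalEquality using (_≡_)
open import Data.List.Relation.Binary.Permutation.Propositional using (_↭_)

data Formula : Set where
  atom : ℕ → Formula
  ⊤ᶠ ⊥ᶠ : Formula
  ¬ᶠ_ : Formula → Formula
  _∧ᶠ_ _∨ᶠ_ _⇒ᶠ_ : Formula → Formula → Formula

infixr 6 _∧ᶠ_
infixr 5 _∨ᶠ_
infixr 4 _⇒ᶠ_
infix 7 ¬ᶠ_

Valuation : Set
Valuation = ℕ → Bool

⟦_⟧ : Formula → Valuation → Bool
⟦ atom n ⟧ v = v n
⟦ ⊤ᶠ ⟧ v = true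
⟦ ⊥ᶠ ⟧ v = false
⟦ ¬ᶠ A ⟧ v = not (⟦ A ⟧ v)
⟦ A ∧ᶠ B ⟧ v = ⟦ A ⟧ v ∧ ⟦ B ⟧ v
⟦ A ∨ᶠ B ⟧ v = ⟦ A ⟧ v ∨ ⟦ B ⟧ v
⟦ A ⇒ᶠ B ⟧ v = not (⟦ A ⟧ v) ∨ ⟦ B ⟧ v

-- LK derivability of single-formula sequents, via soundness/completeness:
-- "B ⇒ A" derivable iff B ⊨ A;  "B ⇒" iff B ⊨ ⊥;  "⇒ Y" iff ⊤ ⊨ Y.
LK⟨_⇒_⟩ : Formula → Formula → Set
LK⟨ B ⇒ A ⟩ = ∀ (v : Valuation) → ⟦ B ⟧ v ≡ true → ⟦ A ⟧ v ≡ true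

LK⟨_⇒⟩ : Formula → Set
LK⟨ B ⇒⟩ = ∀ (v : Valuation) → ⟦ B ⟧ v ≡ false

LK⟨⇒_⟩ : Formula → Set
LK⟨⇒ Y ⟩ = ∀ (v : Valuation) → ⟦ Y ⟧ v ≡ true

-- I/O pairs; finite multisets of pairs are lists taken up to permutation
Pair : Set
Pair = Formula × Formula

data C3 : List Pair → Formula → Formula → Set where
  IN  : ∀ {G B Y} → LK⟨ B ⇒⟩ → C3 G B Y
  OUT : ∀ {G B Y} → LK⟨⇒ Y ⟩ → C3 G B Y
  E3  : ∀ {G G' A X B Y} → G ↭ ((A , X) ∷ G') →
        LK⟨ B ⇒ A ⟩ → C3 G' (B ∧ᶠ X) (Y ∨ᶠ ¬ᶠ X) → C3 G B Y

-- IN and OUT survive strengthening B to B ∧ X and weakening Y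
-- to Y ∨ ¬X. At an E3 step the discharged pair is either (A , X) itself, whose premise is
-- already the goal, or another pair (A′ , X′); then E3 can discharge (A′ , X′) first and the
-- induction hypothesis handles (A , X), the two ways of adding X and X′ to the sequent being
-- equivalent.
module Submission where

open import Defs
open import Algebra.Bundles using (CommutativeMonoid)
open import Data.Bool using (Bool; true; false; _∧_; _∨_)
open import Data.Bool.Properties using (∧-commutativeMonoid; ∨-commutativeMonoid; ∨-zeroʳ; ¬-not)
open import Data.List using (List; _∷_; _++_)
open import Data.List.Membership.Propositional.Properties using (∈-∃++)
open import Data.List.Relation.Binary.Permutation.Propositional using (_↭_; ↭-sym; ↭-refl; ↭-trans; prep; swap)
open import Data.List.Relation.Binary.Permutation.Propositional.Properties using (∈-resp-↭; shift; drop-∷)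
open import Data.List.Relation.Unary.Any using (here; there)
open import Data.Product using (_×_; _,_; ∃-syntax)
open import Data.Sum using (_⊎_; inj₁; inj₂)
open import Function using (_∘_)
open import Relation.Binary.PropositionalEquality using (_≡_; refl; sym; trans; cong; subst)
open import Relation.Nullary using (contradiction)

open import Algebra.Properties.CommutativeSemigroup (CommutativeMonoid.commutativeSemigroup ∧-commutativeMonoid) using () renaming (xy∙z≈xz∙y to ∧-exchange)
open import Algebra.Properties.CommutativeSemigroup (CommutativeMonoid.commutativeSemigroup ∨-commutativeMonoid) using () renaming (xy∙z≈xz∙y to ∨-exchange)

private variable
  a a′ b : Bool
  A B B′ X Y Y′ : Formula
  G H : List Pair

∧-elimˡ-true : a ∧ b ≡ true → a ≡ true
∧-elimˡ-true {true} _ = refl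

∧-monoˡ-true : (a′ ≡ true → a ≡ true) → a′ ∧ b ≡ true → a ∧ b ≡ true
∧-monoˡ-true {true} h e = trans (cong (_∧ _) (h refl)) e

∨-monoˡ-true : (a ≡ true → a′ ≡ true) → a ∨ b ≡ true → a′ ∨ b ≡ true
∨-monoˡ-true {true}  h _ = cong (_∨ _) (h refl)
∨-monoˡ-true {false} h e = trans (cong (_ ∨_) e) (∨-zeroʳ _)

false-antitone : (a′ ≡ true → a ≡ true) → a ≡ false → a′ ≡ false
false-antitone h a≡false = ¬-not λ a′≡true → contradiction (trans (sym (h a′≡true)) a≡false) λ ()

∷-↭-∷-inv : ∀ {ℓ} {P : Set ℓ} {x y : P} {xs ys} → x ∷ xs ↭ y ∷ ys →
  (x ≡ y × xs ↭ ys) ⊎ ∃[ zs ] (xs ↭ y ∷ zs × ys ↭ x ∷ zs)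
∷-↭-∷-inv {x = x} {y} {ys = ys} p with ∈-resp-↭ (↭-sym p) (here refl)
... | here refl = inj₁ (refl , drop-∷ p)
... | there y∈xs with ∈-∃++ y∈xs
... | us , ws , refl = inj₂ (us ++ ws , shift y us ws , drop-∷ y∷ys↭y∷x∷us++ws)
  where
  y∷ys↭y∷x∷us++ws : y ∷ ys ↭ y ∷ x ∷ us ++ ws
  y∷ys↭y∷x∷us++ws = ↭-trans (↭-sym p) (↭-trans (prep x (shift y us ws)) (swap x y ↭-refl))

C3-resp-↭ : G ↭ H → C3 G B Y → C3 H B Y
C3-resp-↭ _ (IN f)     = IN f
C3-resp-↭ _ (OUT f)    = OUT f
C3-resp-↭ q (E3 p l d) = E3 (↭-trans (↭-sym q) p) l d

C3-mono : LK⟨ B′ ⇒ B ⟩ → LK⟨ Y ⇒ Y′ ⟩ → C3 G B Y → C3 G B′ Y′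
C3-mono h k (IN f)     = IN λ v → false-antitone (h v) (f v)
C3-mono h k (OUT f)    = OUT λ v → k v (f v)
C3-mono h k (E3 p l d) = E3 p (λ v → l v ∘ h v)
  (C3-mono (λ v → ∧-monoˡ-true (h v)) (λ v → ∨-monoˡ-true (k v)) d)

C3-absorb : H ↭ (A , X) ∷ G → C3 H B Y → C3 G (B ∧ᶠ X) (Y ∨ᶠ ¬ᶠ X)
C3-absorb _ (IN f)  = IN λ v → cong (_∧ _) (f v)
C3-absorb _ (OUT f) = OUT λ v → cong (_∨ _) (f v)
C3-absorb {X = X} {B = B} {Y = Y} q (E3 {X = X′} p l d) with ∷-↭-∷-inv (↭-trans (↭-sym q) p)
... | inj₁ (refl , r) = C3-resp-↭ (↭-sym r) d
... | inj₂ (_ , r , r′) =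
  E3 r (λ v → l v ∘ ∧-elimˡ-true)
     (C3-mono reorder-inputs reorder-outputs (C3-absorb r′ d))
  where
  reorder-inputs : LK⟨ (B ∧ᶠ X) ∧ᶠ X′ ⇒ (B ∧ᶠ X′) ∧ᶠ X ⟩
  reorder-inputs v = subst (_≡ true) (∧-exchange (⟦ B ⟧ v) (⟦ X ⟧ v) (⟦ X′ ⟧ v))
  reorder-outputs : LK⟨ (Y ∨ᶠ ¬ᶠ X′) ∨ᶠ ¬ᶠ X ⇒ (Y ∨ᶠ ¬ᶠ X) ∨ᶠ ¬ᶠ X′ ⟩
  reorder-outputs v = subst (_≡ true) (∨-exchange (⟦ Y ⟧ v) _ _)

lemma5 : (G : List Pair) (A X B Y : Formula) →
    C3 ((A , X) ∷ G) B Y → C3 G (B ∧ᶠ X) (Y ∨ᶠ ¬ᶠ X)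
lemma5 G A X B Y = C3-absorb ↭-refl
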